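{- For every natural number $n\geq 2$, \[ \varphi^4(n)+\psi^4(n)+\sigma^4(n)\geq 3n^4+4n^3+18n^2+4n+3. \]
   Context: For a natural number $n$, $\varphi(n)$ is Euler's totient function (the number of positive integers not exceeding $n$ that are coprime to $n$). For $n=p_1^{a_1}\cdots p_k^{a_k}$ (distinct primes $p_i$, $a_i\geq1$), the Dedekind function is $\psi(n)=\prod_{i=1}^k p_i^{a_i-1}(p_i+1)$, with $\psi(1)=1$. $\sigma(n)$ denotes the sum of the positive divisors of $n$. -}

module Defs where

open import Data.Nat using (ℕ; zero; suc; _+_; _*_; _∸_; _^_)
open import Data.Nat.Divisibility using (_∣?_)
open import Data.Nat.GCD using (gcd)
open import Data.Nat.Primality using (prime?)
open import Data.List using (List; filter; map; upTo; length; foldr)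
open import Relation.Nullary.Decidable using (_×-dec_)
open import Data.Nat.Properties using (_≟_)

range1 : ℕ → List ℕ
range1 n = map suc (upTo n)

sumL : List ℕ → ℕ
sumL = foldr _+_ 0

prodL : List ℕ → ℕ
prodL = foldr _*_ 1

φ : ℕ → ℕ
φ n = length (filter (λ k → gcd k n ≟ 1) (range1 n))

σ : ℕ → ℕ
σ n = sumL (filter (λ d → d ∣? n) (range1 n))

-- p-adic valuation of n (n ≥ 1, p ≥ 2): the number of a ∈ {1..n} with p^a ∣ n
-- (p^a ∣ n is downward closed in a and forces a ≤ n, so this is the exponent)
val : ℕ → ℕ → ℕ
val p n = length (filter (λ a → (p ^ a) ∣? n) (range1 n))

primeDivisors : ℕ → List ℕ
primeDivisors n = filter (λ p → prime? p ×-dec (p ∣? n)) (range1 n)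

ψ : ℕ → ℕ
ψ n = prodL (map (λ p → p ^ (val p n ∸ 1) * (p + 1)) (primeDivisors n))

-- Let n ≥ 2. Then φ(n) ≤ n − 1, since n is not coprime to itself. Next σ(n) ≥ 2n − φ(n): a
-- k ≤ n not coprime to n satisfies n ∣ k·e for the proper divisor e = n / gcd(k, n), and for a
-- fixed e at most e of the k ≤ n do, so there are at most σ(n) − n such k. Finally
-- ψ(n) = ∏ p^(a−1)(p + 1) exceeds ∏ p^a = n. By convexity of x ↦ x⁴,
-- φ⁴ + σ⁴ ≥ φ⁴ + (2n − φ)⁴ ≥ (n − 1)⁴ + (n + 1)⁴, and (n − 1)⁴ + 2(n + 1)⁴ is the right-hand side.
module Submission where

open import Data.Empty using (⊥-elim)
open import Data.List using (List; []; _∷_; _++_; [_]; filter; map; upTo; length)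
open import Data.List.Membership.Propositional using (_∈_; lose)
open import Data.List.Membership.Propositional.Properties
  using (∈-map⁺; ∈-upTo⁺; ∈-filter⁺; ∈-filter⁻)
open import Data.List.Properties
  using (length-map; length-upTo; upTo-∷ʳ; map-++; map-id; filter-++; filter-accept; length-filter; filter-notAll)
open import Data.List.Relation.Unary.All as All using (All; _∷_)
open import Data.List.Relation.Unary.All.Properties using () renaming (map⁺ to All-map⁺)
open import Data.List.Relation.Unary.Any using (here; there)
open import Data.Nat
open import Data.Nat.Divisibility
open import Data.Nat.GCD using (gcd; gcd[m,n]∣m; gcd[m,n]∣n; gcd-greatest)
open import Data.Nat.ListAction using (sum; product)
open import Data.Nat.ListAction.Properties using (sum-++; product≢0)
open import Data.Nat.Primality using (Prime; prime?; prime⇒nonZero; prime⇒nonTrivial)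
open import Data.Nat.Primality.Factorisation using (factorise)
open import Data.Nat.Properties
open import Data.Nat.Solver using (module +-*-Solver)
open import Data.Product using (∃; _×_; _,_; proj₁; proj₂)
open import Data.Sum using (inj₁; inj₂)
open import Function using (_∘′_)
open import Level using (Level)
open import Relation.Binary.PropositionalEquality hiding ([_])
open import Relation.Nullary using (¬_; yes; no)
open import Relation.Nullary.Decidable using (_×-dec_)
open import Relation.Unary using (Pred; Decidable)
open import Relation.Unary.Properties using (∁?)

open import Defs

open +-*-Solver using (solve; _:+_; _:*_; _:^_; _:=_; con)
open ≤-Reasoning

private
  variable
    a b p : Level
    A : Set a
    I : Set b

range1-suc : ∀ n → range1 (suc n) ≡ range1 n ++ [ suc n ]
range1-suc n = trans (cong (map suc) (sym (upTo-∷ʳ n))) (map-++ suc (upTo n) [ n ])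

length-range1 : ∀ n → length (range1 n) ≡ n
length-range1 n = trans (length-map suc (upTo n)) (length-upTo n)

∈-range1⁺ : ∀ {k n} .{{_ : NonZero k}} → k ≤ n → k ∈ range1 n
∈-range1⁺ {suc i} k≤n = ∈-map⁺ suc (∈-upTo⁺ k≤n)

count : {P : Pred A p} → Decidable P → List A → ℕ
count P? xs = length (filter P? xs)

module _ {P : Pred A p} (P? : Decidable P) where

  count-∷ : ∀ {x} xs → P x → count P? (x ∷ xs) ≡ suc (count P? xs)
  count-∷ xs px = cong length (filter-accept P? px)

  count-≤-∷ : ∀ x xs → count P? xs ≤ count P? (x ∷ xs)
  count-≤-∷ x xs with P? x
  ... | yes _ = n≤1+n _
  ... | no  _ = ≤-refl

  count-∷ʳ : ∀ xs {x} → P x → count P? (xs ++ [ x ]) ≡ suc (count P? xs)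
  count-∷ʳ []       px = count-∷ [] px
  count-∷ʳ (y ∷ ys) px with P? y
  ... | yes _ = cong suc (count-∷ʳ ys px)
  ... | no  _ = count-∷ʳ ys px

  count-∷ʳ-¬ : ∀ xs {x} → ¬ P x → count P? (xs ++ [ x ]) ≡ count P? xs
  count-∷ʳ-¬ []       {x} ¬px with P? x
  ... | yes px = ⊥-elim (¬px px)
  ... | no  _  = refl
  count-∷ʳ-¬ (y ∷ ys) ¬px with P? y
  ... | yes _ = cong suc (count-∷ʳ-¬ ys ¬px)
  ... | no  _ = count-∷ʳ-¬ ys ¬px

  count+count-∁≡length : ∀ xs → count P? xs + count (∁? P?) xs ≡ length xs
  count+count-∁≡length []       = refl
  count+count-∁≡length (x ∷ xs) with P? x
  ... | yes _ = cong suc (count+count-∁≡length xs)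
  ... | no  _ = trans (+-suc _ _) (cong suc (count+count-∁≡length xs))

sum-map-mono : ∀ {f g : A → ℕ} xs → (∀ {x} → x ∈ xs → f x ≤ g x) →
               sum (map f xs) ≤ sum (map g xs)
sum-map-mono []       f≤g = z≤n
sum-map-mono (x ∷ xs) f≤g = +-mono-≤ (f≤g (here refl)) (sum-map-mono xs (λ y∈ → f≤g (there y∈)))

sum-map-mono-< : ∀ {f g : A → ℕ} {x} xs → (∀ {y} → y ∈ xs → f y ≤ g y) → x ∈ xs → f x < g x →
                 sum (map f xs) < sum (map g xs)
sum-map-mono-< (y ∷ ys) f≤g (here refl) fx<gx =
  +-mono-<-≤ fx<gx (sum-map-mono ys (λ z∈ → f≤g (there z∈)))
sum-map-mono-< (y ∷ ys) f≤g (there x∈) fx<gx =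
  +-mono-≤-< (f≤g (here refl)) (sum-map-mono-< ys (λ z∈ → f≤g (there z∈)) x∈ fx<gx)

product-map-< : ∀ {f g : A → ℕ} {x} xs → x ∈ xs → (∀ {y} → y ∈ xs → f y < g y) →
                product (map f xs) < product (map g xs)
product-map-< (y ∷ [])     _ f<g = *-monoˡ-< 1 (f<g (here refl))
product-map-< (y ∷ z ∷ zs) _ f<g =
  *-mono-< (f<g (here refl)) (product-map-< (z ∷ zs) (here refl) (λ w∈ → f<g (there w∈)))

count-≤-sum-count : {P : Pred A p} {Q : I → Pred A p} (P? : Decidable P) (Q? : ∀ i → Decidable (Q i))
                    (is : List I) (xs : List A) →
                    (∀ {x} → x ∈ xs → P x → ∃ λ i → i ∈ is × Q i x) →
                    count P? xs ≤ sum (map (λ i → count (Q? i) xs) is)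
count-≤-sum-count P? Q? is []       _       = z≤n
count-≤-sum-count P? Q? is (x ∷ xs) covered with P? x
... | no _ = ≤-trans (count-≤-sum-count P? Q? is xs (λ x∈ → covered (there x∈)))
                     (sum-map-mono is (λ {i} _ → count-≤-∷ (Q? i) x xs))
... | yes px with covered (here refl) px
...   | i , i∈ , qix =
  ≤-trans (s≤s (count-≤-sum-count P? Q? is xs (λ x∈ → covered (there x∈))))
          (sum-map-mono-< is (λ {j} _ → count-≤-∷ (Q? j) x xs) i∈
                          (≤-reflexive (sym (count-∷ (Q? i) xs qix))))

module _ {P : Pred ℕ p} (P? : Decidable P) where

  count-range1-suc : ∀ n → P (suc n) → count P? (range1 (suc n)) ≡ suc (count P? (range1 n))
  count-range1-suc n P[1+n] = trans (cong (count P?) (range1-suc n)) (count-∷ʳ P? (range1 n) P[1+n])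

  count-range1-suc-¬ : ∀ n → ¬ P (suc n) → count P? (range1 (suc n)) ≡ count P? (range1 n)
  count-range1-suc-¬ n ¬P[1+n] = trans (cong (count P?) (range1-suc n)) (count-∷ʳ-¬ P? (range1 n) ¬P[1+n])

  count-range1-≤ : ∀ n → count P? (range1 n) ≤ n
  count-range1-≤ n = ≤-trans (length-filter P? (range1 n)) (≤-reflexive (length-range1 n))

  count-range1*d≤n : ∀ {d} → (∀ {k} → P k → d ∣ k) → ∀ n → count P? (range1 n) * d ≤ n
  count-range1*d≤n         d∣ zero    = z≤n
  count-range1*d≤n {d} d∣ (suc n) with P? (suc n)
  ... | no ¬P[1+n] rewrite count-range1-suc-¬ n ¬P[1+n] = m≤n⇒m≤1+n (count-range1*d≤n d∣ n)
  ... | yes P[1+n] with d∣ P[1+n]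
  ...   | divides q 1+n≡q*d rewrite count-range1-suc n P[1+n] = begin
    suc c * d ≤⟨ *-monoˡ-≤ d c<q ⟩
    q * d     ≡⟨ sym 1+n≡q*d ⟩
    suc n     ∎
    where
    c : ℕ
    c = count P? (range1 n)
    c<q : c < q
    c<q = *-cancelʳ-< d c q (≤-trans (s≤s (count-range1*d≤n d∣ n)) (≤-reflexive 1+n≡q*d))

module _ {P : Pred ℕ p} (P? : Decidable P) (P-down : ∀ {i j} → i ≤ j → P j → P i) where

  P[count-range1] : P 0 → ∀ n → P (count P? (range1 n))
  P[count-range1] P0 zero    = P0
  P[count-range1] P0 (suc n) with P? (suc n)
  ... | yes P[1+n] rewrite count-range1-suc P? n P[1+n] = P-down (s≤s (count-range1-≤ P? n)) P[1+n]
  ... | no ¬P[1+n] rewrite count-range1-suc-¬ P? n ¬P[1+n] = P[count-range1] P0 n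

  ¬P[1+count-range1] : ∀ n → count P? (range1 n) < n → ¬ P (suc (count P? (range1 n)))
  ¬P[1+count-range1] (suc n) c<1+n with P? (suc n)
  ... | yes P[1+n] rewrite count-range1-suc P? n P[1+n] =
    λ P[2+c] → ¬P[1+count-range1] n (≤-pred c<1+n) (P-down (n≤1+n _) P[2+c])
  ... | no ¬P[1+n] rewrite count-range1-suc-¬ P? n ¬P[1+n] with m≤n⇒m<n∨m≡n (≤-pred c<1+n)
  ...   | inj₁ c<n = ¬P[1+count-range1] n c<n
  ...   | inj₂ c≡n = λ P[1+c] → ¬P[1+n] (subst (P ∘′ suc) c≡n P[1+c])

^-monoʳ-∣ : ∀ m {i j} → i ≤ j → m ^ i ∣ m ^ j
^-monoʳ-∣ m {i} i≤j with m≤n⇒∃[o]m+o≡n i≤j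
... | k , refl = subst (m ^ i ∣_) (sym (^-distribˡ-+-* m i k)) (m∣m*n (m ^ k))

n<m^n : ∀ {m} → 1 < m → ∀ n → n < m ^ n
n<m^n 1<m zero    = z<s
n<m^n 1<m (suc n) = ≤-<-trans (n<m^n 1<m n) (^-monoʳ-< _ 1<m (n<1+n n))

p^val∣n : ∀ p n → p ^ val p n ∣ n
p^val∣n p n = P[count-range1] (λ i → p ^ i ∣? n) (λ i≤j → ∣-trans (^-monoʳ-∣ p i≤j)) (1∣ n) n

-- val only inspects exponents up to n, which suffices because p ^ n > n.
¬p^[1+val]∣n : ∀ {p} n .{{_ : NonZero n}} → 1 < p → ¬ p ^ suc (val p n) ∣ n
¬p^[1+val]∣n {p} n 1<p with m≤n⇒m<n∨m≡n (count-range1-≤ (λ i → p ^ i ∣? n) n)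
... | inj₁ v<n = ¬P[1+count-range1] (λ i → p ^ i ∣? n) (λ i≤j → ∣-trans (^-monoʳ-∣ p i≤j)) n v<n
... | inj₂ v≡n = λ _ → <⇒≱ (n<m^n 1<p n) (∣⇒≤ (subst (λ v → p ^ v ∣ n) v≡n (p^val∣n p n)))

val-split : ∀ {p} n .{{_ : NonZero n}} → 1 < p → ∃ λ m → n ≡ p ^ val p n * m × ¬ p ∣ m
val-split {p} n 1<p with p^val∣n p n
... | divides m n≡m*p^v =
  m , trans n≡m*p^v (*-comm m _) ,
  λ p∣m → ¬p^[1+val]∣n n 1<p (subst (p ^ suc (val p n) ∣_) (sym n≡m*p^v) (*-monoˡ-∣ (p ^ val p n) p∣m))

∣⇒val≢0 : ∀ {p} n .{{_ : NonZero n}} → 1 < p → p ∣ n → NonZero (val p n)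
∣⇒val≢0 {p} n 1<p p∣n with val p n | ¬p^[1+val]∣n n 1<p
... | zero  | ¬p^1∣n = ⊥-elim (¬p^1∣n (subst (_∣ n) (sym (*-identityʳ p)) p∣n))
... | suc _ | _      = _

prime⇒1<p : ∀ {p} → Prime p → 1 < p
prime⇒1<p {p} pp = nonTrivial⇒n>1 p {{prime⇒nonTrivial pp}}

∃-prime-∣ : ∀ {n} → 1 < n → ∃ λ p → Prime p × p ∣ n
∃-prime-∣ {n} 1<n with factorise n {{>-nonZero (<⇒≤ 1<n)}}
... | record { factors = [] ; isFactorisation = n≡1 } = ⊥-elim (<⇒≢ 1<n (sym n≡1))
... | record { factors = p ∷ _ ; isFactorisation = n≡p*ps ; factorsPrime = pp ∷ _ } =
  p , pp , subst (p ∣_) (sym n≡p*ps) (m∣m*n _)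

∈-primeDivisors⁺ : ∀ {p n} .{{_ : NonZero n}} → Prime p → p ∣ n → p ∈ primeDivisors n
∈-primeDivisors⁺ {n = n} pp p∣n =
  ∈-filter⁺ (λ q → prime? q ×-dec (q ∣? n)) (∈-range1⁺ {{prime⇒nonZero pp}} (∣⇒≤ p∣n)) (pp , p∣n)

∈-primeDivisors⁻ : ∀ {p n} → p ∈ primeDivisors n → Prime p × p ∣ n
∈-primeDivisors⁻ {n = n} p∈ = proj₂ (∈-filter⁻ (λ q → prime? q ×-dec (q ∣? n)) {xs = range1 n} p∈)

∣-product-^ : (e : ℕ → ℕ) → ∀ ps → All Prime ps → ∀ n .{{_ : NonZero n}} →
              (∀ {p} → Prime p → p ∣ n → p ∈ ps) → All (λ p → ¬ p ^ suc (e p) ∣ n) ps →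
              n ∣ product (map (λ p → p ^ e p) ps)
∣-product-^ e [] _ 1      _        _ = ∣-refl
∣-product-^ e [] _ (2+ n) prime∣⇒∈ _ with ∃-prime-∣ {2+ n} (s≤s (s≤s z≤n))
... | _ , pp , p∣n with prime∣⇒∈ pp p∣n
... | ()
∣-product-^ e (p ∷ ps) (pp ∷ pps) n {{n≢0}} prime∣⇒∈ (¬p^∣n ∷ ¬ps^∣n) = peel (val-split n (prime⇒1<p pp))
  where
  peel : (∃ λ m → n ≡ p ^ val p n * m × ¬ p ∣ m) → n ∣ p ^ e p * product (map (λ q → q ^ e q) ps)
  peel (m , n≡p^v*m , ¬p∣m) =
    subst (_∣ _) (sym n≡p^v*m) (*-pres-∣ (^-monoʳ-∣ p v≤e) m∣∏ps)
    where
    m≢0 : NonZero m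
    m≢0 = m*n≢0⇒n≢0 (p ^ val p n) {{subst NonZero n≡p^v*m n≢0}}
    m∣n : m ∣ n
    m∣n = divides (p ^ val p n) n≡p^v*m
    v≤e : val p n ≤ e p
    v≤e = ≮⇒≥ (λ e<v → ¬p^∣n (∣-trans (^-monoʳ-∣ p e<v) (p^val∣n p n)))
    prime∣m⇒∈ : ∀ {q} → Prime q → q ∣ m → q ∈ ps
    prime∣m⇒∈ qq q∣m with prime∣⇒∈ qq (∣-trans q∣m m∣n)
    ... | here refl = ⊥-elim (¬p∣m q∣m)
    ... | there q∈  = q∈
    m∣∏ps : m ∣ product (map (λ q → q ^ e q) ps)
    m∣∏ps = ∣-product-^ e ps pps m {{m≢0}} prime∣m⇒∈
              (All.map (λ ¬q^∣n q^∣m → ¬q^∣n (∣-trans q^∣m m∣n)) ¬ps^∣n)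

m^n<m^[n∸1]*[m+1] : ∀ m n .{{_ : NonZero m}} .{{_ : NonZero n}} → m ^ n < m ^ (n ∸ 1) * (m + 1)
m^n<m^[n∸1]*[m+1] m (suc n) = begin-strict
  m * m ^ n         <⟨ m<m+n (m * m ^ n) (m^n>0 m n) ⟩
  m * m ^ n + m ^ n ≡⟨ solve 2 (λ m x → m :* x :+ x := x :* (m :+ con 1)) refl m (m ^ n) ⟩
  m ^ n * (m + 1)   ∎

n<ψ : ∀ {n} → 1 < n → n < ψ n
n<ψ {n} 1<n with ∃-prime-∣ 1<n
... | p , pp , p∣n = begin-strict
  n                                    ≤⟨ ∣⇒≤ {{product≢0 (All-map⁺ (All.tabulate p^v≢0))}} n∣∏p^v ⟩
  product (map (λ q → q ^ val q n) ps) <⟨ product-map-< ps (∈-primeDivisors⁺ pp p∣n) p^v<ψ-factor ⟩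
  ψ n                                  ∎
  where
  instance
    n≢0 : NonZero n
    n≢0 = >-nonZero (<⇒≤ 1<n)
  ps : List ℕ
  ps = primeDivisors n
  prime : ∀ {q} → q ∈ ps → Prime q
  prime q∈ = proj₁ (∈-primeDivisors⁻ {n = n} q∈)
  p^v≢0 : ∀ {q} → q ∈ ps → NonZero (q ^ val q n)
  p^v≢0 {q} q∈ = m^n≢0 q (val q n) {{prime⇒nonZero (prime q∈)}}
  n∣∏p^v : n ∣ product (map (λ q → q ^ val q n) ps)
  n∣∏p^v = ∣-product-^ (λ q → val q n) ps (All.tabulate prime) n ∈-primeDivisors⁺
             (All.tabulate (λ q∈ → ¬p^[1+val]∣n n (prime⇒1<p (prime q∈))))
  p^v<ψ-factor : ∀ {q} → q ∈ ps → q ^ val q n < q ^ (val q n ∸ 1) * (q + 1)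
  p^v<ψ-factor {q} q∈ = m^n<m^[n∸1]*[m+1] q (val q n) {{prime⇒nonZero (prime q∈)}}
    {{∣⇒val≢0 n (prime⇒1<p (prime q∈)) (proj₂ (∈-primeDivisors⁻ q∈))}}

gcd[n,n]≡n : ∀ n → gcd n n ≡ n
gcd[n,n]≡n n = ∣-antisym (gcd[m,n]∣m n n) (gcd-greatest ∣-refl ∣-refl)

φ<n : ∀ {n} → 1 < n → φ n < n
φ<n {n} 1<n = subst (φ n <_) (length-range1 n)
  (filter-notAll (λ k → gcd k n ≟ 1) (range1 n) (lose (∈-range1⁺ {{n≢0}} ≤-refl) gcd[n,n]≢1))
  where
  n≢0 : NonZero n
  n≢0 = >-nonZero (<⇒≤ 1<n)
  gcd[n,n]≢1 : gcd n n ≢ 1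
  gcd[n,n]≢1 gcd[n,n]≡1 = <⇒≢ 1<n (trans (sym gcd[n,n]≡1) (gcd[n,n]≡n n))

properDivisors : ℕ → List ℕ
properDivisors n = filter (_∣? n) (range1 (pred n))

σ≡sum[properDivisors]+n : ∀ n .{{_ : NonZero n}} → σ n ≡ sum (properDivisors n) + n
σ≡sum[properDivisors]+n n@(suc m) = begin-equality
  sum (filter (_∣? n) (range1 (suc m)))    ≡⟨ cong (sum ∘′ filter (_∣? n)) (range1-suc m) ⟩
  sum (filter (_∣? n) (range1 m ++ [ n ])) ≡⟨ cong sum (filter-++ (_∣? n) (range1 m) [ n ]) ⟩
  sum (ds ++ filter (_∣? n) [ n ])         ≡⟨ cong (λ ns → sum (ds ++ ns)) (filter-accept (_∣? n) ∣-refl) ⟩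
  sum (ds ++ [ n ])                        ≡⟨ sum-++ ds [ n ] ⟩
  sum ds + (n + 0)                         ≡⟨ cong (sum ds +_) (+-identityʳ n) ⟩
  sum ds + n                               ∎
  where
  ds : List ℕ
  ds = properDivisors n

¬coprime⇒∃properDivisor : ∀ {k n} .{{_ : NonZero n}} → gcd k n ≢ 1 →
                          ∃ λ e → e ∈ properDivisors n × n ∣ k * e
¬coprime⇒∃properDivisor {k} {n@(suc m)} {{n≢0}} g≢1 with gcd[m,n]∣n k n
... | divides e n≡e*g = e , ∈-filter⁺ (_∣? n) (∈-range1⁺ {{e≢0}} (≤-pred e<n)) e∣n , n∣k*e
  where
  g : ℕ
  g = gcd k n
  e≢0 : NonZero e
  e≢0 = m*n≢0⇒m≢0 e {{subst NonZero n≡e*g n≢0}}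
  1<g : 1 < g
  1<g = ≤∧≢⇒< (>-nonZero⁻¹ g {{m*n≢0⇒n≢0 e {{subst NonZero n≡e*g n≢0}}}}) (λ 1≡g → g≢1 (sym 1≡g))
  e<n : e < n
  e<n = begin-strict
    e      ≡⟨ sym (*-identityʳ e) ⟩
    e * 1  <⟨ *-monoʳ-< e {{e≢0}} 1<g ⟩
    e * g  ≡⟨ sym n≡e*g ⟩
    n      ∎
  e∣n : e ∣ n
  e∣n = divides g (trans n≡e*g (*-comm e g))
  n∣k*e : n ∣ k * e
  n∣k*e = subst (_∣ k * e) (trans (*-comm g e) (sym n≡e*g)) (*-monoˡ-∣ e (gcd[m,n]∣m k n))

count[n∣k*e]≤e : ∀ {e n} .{{_ : NonZero n}} → e ∣ n → count (λ k → n ∣? k * e) (range1 n) ≤ e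
count[n∣k*e]≤e {e} {n} {{n≢0}} (divides g n≡g*e) =
  *-cancelʳ-≤ _ e g {{g≢0}} (begin
    count (λ k → n ∣? k * e) (range1 n) * g ≤⟨ count-range1*d≤n (λ k → n ∣? k * e) g∣k n ⟩
    n                                       ≡⟨ trans n≡g*e (*-comm g e) ⟩
    e * g                                   ∎)
  where
  g≢0 : NonZero g
  g≢0 = m*n≢0⇒m≢0 g {{subst NonZero n≡g*e n≢0}}
  e≢0 : NonZero e
  e≢0 = m*n≢0⇒n≢0 g {{subst NonZero n≡g*e n≢0}}
  g∣k : ∀ {k} → n ∣ k * e → g ∣ k
  g∣k n∣k*e = *-cancelʳ-∣ e {{e≢0}} (subst (_∣ _) n≡g*e n∣k*e)

n+n≤φ+σ : ∀ n .{{_ : NonZero n}} → n + n ≤ φ n + σ n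
n+n≤φ+σ n = begin
  n + n                        ≡⟨ cong (_+ n) (sym φ+#non-coprime≡n) ⟩
  φ n + #non-coprime + n       ≤⟨ +-monoˡ-≤ n (+-monoʳ-≤ (φ n) #non-coprime≤sum[ds]) ⟩
  φ n + sum ds + n             ≡⟨ +-assoc (φ n) (sum ds) n ⟩
  φ n + (sum ds + n)           ≡⟨ cong (φ n +_) (sym (σ≡sum[properDivisors]+n n)) ⟩
  φ n + σ n                    ∎
  where
  coprime? : Decidable (λ k → gcd k n ≡ 1)
  coprime? k = gcd k n ≟ 1
  multiple? : ∀ e → Decidable (λ k → n ∣ k * e)
  multiple? e k = n ∣? k * e
  ds : List ℕ
  ds = properDivisors n
  #non-coprime : ℕ
  #non-coprime = count (∁? coprime?) (range1 n)
  φ+#non-coprime≡n : φ n + #non-coprime ≡ n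
  φ+#non-coprime≡n = trans (count+count-∁≡length coprime? (range1 n)) (length-range1 n)
  covered : ∀ {k} → k ∈ range1 n → gcd k n ≢ 1 → ∃ λ e → e ∈ ds × n ∣ k * e
  covered {k} _ = ¬coprime⇒∃properDivisor {k}
  #multiples≤e : ∀ {e} → e ∈ ds → count (multiple? e) (range1 n) ≤ e
  #multiples≤e e∈ = count[n∣k*e]≤e (proj₂ (∈-filter⁻ (_∣? n) {xs = range1 (pred n)} e∈))
  #non-coprime≤sum[ds] : #non-coprime ≤ sum ds
  #non-coprime≤sum[ds] = begin
    #non-coprime                                        ≤⟨ count-≤-sum-count (∁? coprime?) multiple? ds (range1 n) covered ⟩
    sum (map (λ e → count (multiple? e) (range1 n)) ds) ≤⟨ sum-map-mono ds #multiples≤e ⟩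
    sum (map (λ e → e) ds)                              ≡⟨ cong sum (map-id ds) ⟩
    sum ds                                              ∎

^4-spread : ∀ i d {y} → i + d ≤ y → (i + d) ^ 4 + y ^ 4 ≤ i ^ 4 + (y + d) ^ 4
^4-spread i d i+d≤y with m≤n⇒∃[o]m+o≡n i+d≤y
... | c , refl = begin
  (i + d) ^ 4 + (i + d + c) ^ 4                  ≤⟨ m≤m+n _ _ ⟩
  (i + d) ^ 4 + (i + d + c) ^ 4 + d * remainder  ≡⟨ sym spread-identity ⟩
  i ^ 4 + (i + d + c + d) ^ 4                    ∎
  where
  remainder : ℕ
  remainder = 14 * d ^ 3 + 28 * c * d ^ 2 + 18 * c ^ 2 * d + 4 * c ^ 3 + 24 * i * d ^ 2
            + 36 * i * c * d + 12 * i * c ^ 2 + 12 * i ^ 2 * d + 12 * i ^ 2 * c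
  spread-identity : i ^ 4 + (i + d + c + d) ^ 4 ≡ (i + d) ^ 4 + (i + d + c) ^ 4 + d * remainder
  spread-identity = solve 3 (λ i c d →
      i :^ 4 :+ (i :+ d :+ c :+ d) :^ 4
    := (i :+ d) :^ 4 :+ (i :+ d :+ c) :^ 4
       :+ d :* (con 14 :* d :^ 3 :+ con 28 :* c :* d :^ 2 :+ con 18 :* c :^ 2 :* d :+ con 4 :* c :^ 3
                :+ con 24 :* i :* d :^ 2 :+ con 36 :* i :* c :* d :+ con 12 :* i :* c :^ 2
                :+ con 12 :* i :^ 2 :* d :+ con 12 :* i :^ 2 :* c)) refl i c d

fourth-powers-bound : ∀ k u w v → u ≤ k → suc k + suc k ≤ u + v → suc k < w →
  3 * suc k ^ 4 + 4 * suc k ^ 3 + 18 * suc k ^ 2 + 4 * suc k + 3 ≤ u ^ 4 + w ^ 4 + v ^ 4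
fourth-powers-bound k u w v u≤k n+n≤u+v n<w with m≤n⇒∃[o]m+o≡n u≤k
... | t , refl = begin
  3 * suc k ^ 4 + 4 * suc k ^ 3 + 18 * suc k ^ 2 + 4 * suc k + 3 ≡⟨ rhs-identity ⟩
  k ^ 4 + (2 + k) ^ 4 + (2 + k) ^ 4                              ≤⟨ +-monoˡ-≤ _ (^4-spread u t (m≤n+m k 2)) ⟩
  u ^ 4 + (2 + k + t) ^ 4 + (2 + k) ^ 4                          ≤⟨ +-mono-≤ (+-monoʳ-≤ (u ^ 4) (^-monoˡ-≤ 4 2+k+t≤v))
                                                                              (^-monoˡ-≤ 4 n<w) ⟩
  u ^ 4 + v ^ 4 + w ^ 4                                          ≡⟨ +-assoc (u ^ 4) _ _ ⟩
  u ^ 4 + (v ^ 4 + w ^ 4)                                        ≡⟨ cong (u ^ 4 +_) (+-comm (v ^ 4) _) ⟩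
  u ^ 4 + (w ^ 4 + v ^ 4)                                        ≡⟨ sym (+-assoc (u ^ 4) _ _) ⟩
  u ^ 4 + w ^ 4 + v ^ 4                                          ∎
  where
  rhs-identity : 3 * suc k ^ 4 + 4 * suc k ^ 3 + 18 * suc k ^ 2 + 4 * suc k + 3 ≡ k ^ 4 + (2 + k) ^ 4 + (2 + k) ^ 4
  rhs-identity = solve 1 (λ k →
      con 3 :* (con 1 :+ k) :^ 4 :+ con 4 :* (con 1 :+ k) :^ 3 :+ con 18 :* (con 1 :+ k) :^ 2
      :+ con 4 :* (con 1 :+ k) :+ con 3
    := k :^ 4 :+ (con 2 :+ k) :^ 4 :+ (con 2 :+ k) :^ 4) refl k
  n+n≡u+[2+k+t] : suc k + suc k ≡ u + (2 + k + t)
  n+n≡u+[2+k+t] = solve 2 (λ u t → (con 1 :+ (u :+ t)) :+ (con 1 :+ (u :+ t)) := u :+ (con 2 :+ (u :+ t) :+ t)) refl u t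
  2+k+t≤v : 2 + k + t ≤ v
  2+k+t≤v = +-cancelˡ-≤ u _ _ (subst (_≤ u + v) n+n≡u+[2+k+t] n+n≤u+v)

theorem2 : (n : ℕ) → 2 ≤ n →
    3 * n ^ 4 + 4 * n ^ 3 + 18 * n ^ 2 + 4 * n + 3 ≤ φ n ^ 4 + ψ n ^ 4 + σ n ^ 4
theorem2 n@(suc k) 1<n =
  fourth-powers-bound k (φ n) (ψ n) (σ n) (≤-pred (φ<n 1<n)) (n+n≤φ+σ n) (n<ψ 1<n)
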